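{- For each integer $k \geq 2$ there exists a graph $G$ with $\operatorname{ia}(G)=k$ and an edge $e \in E(G)$ such that in every cover of $E(G)$ by $k$ induced forests of $G$, the edge $e$ belongs to all $k$ of these forests.
   Context: All graphs are finite and simple. A subgraph $H$ of a graph $G$ is induced if for all $u,v\in V(H)$ with $uv\in E(G)$ we have $uv\in E(H)$. An induced forest of $G$ is an induced subgraph of $G$ that is a forest. The induced arboricity $\operatorname{ia}(G)$ is the smallest number of induced forests of $G$ whose edge sets together cover $E(G)$ (the forests need not be edge-disjoint). -}

module Defs where

open import Data.Nat using (ℕ; zero; suc; _<_; _≥_)
open import Data.Fin using (Fin; zero; suc; inject₁; fromℕ)
open import Data.Fin.Subset using (Subset; _∈_)
open import Data.Bool using (Bool; true; false)
open import Data.Product using (Σ; ∃; _×_; _,_)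
open import Relation.Binary.PropositionalEquality using (_≡_)
open import Relation.Nullary using (¬_)
open import Function.Definitions using (Injective)

record Graph : Set where
  field
    n     : ℕ
    adj   : Fin n → Fin n → Bool
    sym   : ∀ u v → adj u v ≡ adj v u
    irrefl : ∀ u → adj u u ≡ false

open Graph public

Adj : (G : Graph) → Fin (n G) → Fin (n G) → Set
Adj G u v = adj G u v ≡ true

record Cycle (G : Graph) : Set where
  field
    k       : ℕ
    len≥3   : k ≥ 2
    c       : Fin (suc k) → Fin (n G)
    inj     : Injective _≡_ _≡_ c
    step    : ∀ (i : Fin k) → Adj G (c (inject₁ i)) (c (suc i))
    close   : Adj G (c (fromℕ k)) (c zero)

-- An induced subgraph of G is determined by its vertex set S; G[S] has all
-- edges of G between vertices of S. G[S] is a forest iff it has no cycle.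
IsInducedForest : (G : Graph) → Subset (n G) → Set
IsInducedForest G S =
  ¬ (Σ (Cycle G) λ C → ∀ i → Cycle.c C i ∈ S)

EdgeIn : (G : Graph) → Fin (n G) → Fin (n G) → Subset (n G) → Set
EdgeIn G u v S = u ∈ S × v ∈ S

record ForestCover (G : Graph) (k : ℕ) : Set where
  field
    F      : Fin k → Subset (n G)
    forest : ∀ i → IsInducedForest G (F i)
    covers : ∀ u v → Adj G u v → ∃ λ i → EdgeIn G u v (F i)

InducedArboricity : Graph → ℕ → Set
InducedArboricity G k = ForestCover G k × (∀ j → j < k → ¬ ForestCover G j)

-- Join two copies of K_{k,k+1} by a bridge between a vertex of the (k+1)-side of each copy.
-- An induced forest meets a copy in a C4-free induced subgraph of K_{k,k+1}, that is, in a star,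
-- and a star has a single centre on one side. Fewer than k stars leave a vertex of each side that
-- is nobody's centre, and the edge between them is uncovered. The k forests "i-th vertex of the
-- k-side in both copies, plus both (k+1)-sides" are two stars joined by the bridge, hence trees,
-- and cover everything. In a cover by exactly k forests some vertex j₀ of the (k+1)-side is no
-- centre, so the edges a j₀ force every forest to be a star centred on the k-side, and covering
-- the edges at its centre then forces it to contain the whole (k+1)-side, bridge included.
module Submission where

open import Defs hiding (sym)
open import Data.Bool using (Bool; true; false; not)
open import Data.Bool.Properties using () renaming (_≟_ to _≟ᵇ_)
open import Data.Empty using (⊥; ⊥-elim)
open import Data.Fin using (Fin; zero; suc; inject₁; fromℕ; fromℕ<; punchOut)
open import Data.Fin.Properties
  using (_≟_; any?; all?; injective⇒≤; punchOut-injective; 2↔Bool; +↔⊎; *↔×)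
  renaming (suc-injective to fin-suc-injective)
open import Data.Fin.Relation.Unary.Top using (view; ‵fromℕ; ‵inj₁)
open import Data.Fin.Subset using (Subset; _∈_)
open import Data.Fin.Subset.Properties using (_∈?_)
open import Data.Nat using (ℕ; zero; suc; _+_; _*_; _<_; _≤_; _≥_; s≤s; z≤n)
open import Data.Nat.Properties using (<⇒≱; ≤-refl; ≤-<-trans; n<1+n; m<n⇒m<1+n)
open import Data.Product using (Σ; ∃; ∃₂; _×_; _,_; proj₁; proj₂; map; map₂)
open import Data.Product.Properties using (,-injectiveʳ)
open import Data.Product.Function.NonDependent.Propositional using (_×-↔_)
open import Data.Sum using (_⊎_; inj₁; inj₂; swap; [_,_])
open import Data.Sum.Properties using (inj₁-injective; inj₂-injective)
open import Data.Vec using (tabulate)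
open import Data.Vec.Properties using (lookup∘tabulate; lookup⇒[]=; []=⇒lookup)
open import Function using (_∘_; _↔_; mk⇔; Inverse)
open import Function.Definitions using (Injective)
open import Function.Properties.Inverse using (↔-sym; ↔-trans)
open import Level using (0ℓ)
open import Relation.Binary using (Rel; Decidable)
open import Relation.Binary.PropositionalEquality
  using (_≡_; _≢_; refl; sym; trans; cong; subst; subst₂)
open import Relation.Nullary using (¬_; Dec; yes; no; does; ¬?)
open import Relation.Nullary.Decidable using (dec-true; dec-false; does-⇔; decidable-stable; _⊎-dec_; _×-dec_)
open import Relation.Nullary.Negation using (contradiction)
open import Relation.Unary using (Pred) renaming (Decidable to Decidable₁)

<⇒∃missed : ∀ {m n} → m < n → (h : Fin m → Fin n) → ∃ λ y → ∀ x → h x ≢ y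
<⇒∃missed {m} {n} m<n h with any? (λ y → all? (λ x → ¬? (h x ≟ y)))
... | yes missed = missed
... | no ¬missed = contradiction (injective⇒≤ section-injective) (<⇒≱ m<n)
  where
  preimage : ∀ y → ∃ λ x → h x ≡ y
  preimage y = decidable-stable (any? (λ x → h x ≟ y))
    (λ ∄x → ¬missed (y , λ x hx≡y → ∄x (x , hx≡y)))
  section-injective : Injective _≡_ _≡_ (proj₁ ∘ preimage)
  section-injective {y} {y′} e =
    trans (sym (proj₂ (preimage y))) (trans (cong h e) (proj₂ (preimage y′)))

injective⇒surjective : ∀ {m n} → n ≤ m → (h : Fin m → Fin n) → Injective _≡_ _≡_ h →
                       ∀ y → ∃ λ x → h x ≡ y
injective⇒surjective {n = suc n} n≤m h h-injective y with any? (λ x → h x ≟ y)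
... | yes hit = hit
... | no ¬hit = contradiction (injective⇒≤ punched-injective) (<⇒≱ n≤m)
  where
  y≢h : ∀ x → y ≢ h x
  y≢h x y≡hx = ¬hit (x , sym y≡hx)
  punched-injective : Injective _≡_ _≡_ (λ x → punchOut (y≢h x))
  punched-injective e = h-injective (punchOut-injective (y≢h _) (y≢h _) e)

module _ {A : Set} where

  AtMostOne : Pred A 0ℓ → Set
  AtMostOne P = ∀ {x y} → P x → P y → x ≡ y

  DistinctPair : Pred A 0ℓ → Set
  DistinctPair P = ∃₂ λ x y → x ≢ y × P x × P y

atMostOne⊎distinctPair : ∀ {k} {P : Pred (Fin k) 0ℓ} → Decidable₁ P → AtMostOne P ⊎ DistinctPair P
atMostOne⊎distinctPair {P = P} P? with any? P?
... | no ∄x = inj₁ λ Px _ → ⊥-elim (∄x (_ , Px))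
... | yes (x , Px) with any? (λ y → P? y ×-dec ¬? (y ≟ x))
...   | yes (y , Py , y≢x) = inj₂ (y , x , y≢x , Py , Px)
...   | no ∄y = inj₁ λ Py Pz → trans (onlyX Py) (sym (onlyX Pz))
  where
  onlyX : ∀ {y} → P y → y ≡ x
  onlyX {y} Py = decidable-stable (y ≟ x) (λ y≢x → ∄y (y , Py , y≢x))

centre : ∀ {k} {P : Pred (Fin k) 0ℓ} → Fin k → Decidable₁ P → Fin k
centre r₀ P? with any? P?
... | yes (x , _) = x
... | no _ = r₀

centre-unique : ∀ {k} {P : Pred (Fin k) 0ℓ} (r₀ : Fin k) (P? : Decidable₁ P) →
                AtMostOne P → ∀ {x} → P x → x ≡ centre r₀ P?
centre-unique r₀ P? P≤1 Px with any? P?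
... | yes (_ , Py) = P≤1 Px Py
... | no ∄x = ⊥-elim (∄x (_ , Px))

-- A cover of the complete bipartite graph between Fin k and Fin N by m subgraphs (InA f, InB f)
-- none of which contains a 4-cycle; each of them is therefore a star.
module StarCover {m k N : ℕ}
  (InA : Fin m → Pred (Fin k) 0ℓ) (InB : Fin m → Pred (Fin N) 0ℓ)
  (InA? : ∀ f → Decidable₁ (InA f)) (InB? : ∀ f → Decidable₁ (InB f))
  (covers : ∀ a j → ∃ λ f → InA f a × InB f j)
  (no-square : ∀ f → DistinctPair (InA f) → DistinctPair (InB f) → ⊥)
  where

  isStar : ∀ f → AtMostOne (InA f) ⊎ AtMostOne (InB f)
  isStar f with atMostOne⊎distinctPair (InA? f) | atMostOne⊎distinctPair (InB? f)
  ... | inj₁ A≤1 | _          = inj₁ A≤1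
  ... | inj₂ _   | inj₁ B≤1   = inj₂ B≤1
  ... | inj₂ A≥2 | inj₂ B≥2   = ⊥-elim (no-square f A≥2 B≥2)

  too-few-stars : m < k → m < N → ⊥
  too-few-stars m<k m<N
    with <⇒∃missed m<k (λ f → centre (fromℕ< m<k) (InA? f))
       | <⇒∃missed m<N (λ f → centre (fromℕ< m<N) (InB? f))
  ... | a , a-missed | j , j-missed with covers a j
  ... | f , Aa , Bj with isStar f
  ...   | inj₁ A≤1 = a-missed f (sym (centre-unique _ (InA? f) A≤1 Aa))
  ...   | inj₂ B≤1 = j-missed f (sym (centre-unique _ (InB? f) B≤1 Bj))

  -- Some j₀ is the centre of no star, so the star covering a j₀ is centred at a; these k stars are
  -- distinct, hence they are all the stars, and the star covering a j is the one centred at a.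
  stars-contain-B : m ≤ k → k < N → ∀ f j → InB f j
  stars-contain-B m≤k k<N = contains
    where
    centreB : Fin m → Fin N
    centreB f = centre (fromℕ< (≤-<-trans m≤k k<N)) (InB? f)

    j₀ : Fin N
    j₀ = proj₁ (<⇒∃missed (≤-<-trans m≤k k<N) centreB)

    j₀-missed : ∀ f → centreB f ≢ j₀
    j₀-missed = proj₂ (<⇒∃missed (≤-<-trans m≤k k<N) centreB)

    star : Fin k → Fin m
    star a = proj₁ (covers a j₀)

    star-A : ∀ a → InA (star a) a
    star-A a = proj₁ (proj₂ (covers a j₀))

    star-centred : ∀ a {a′} → InA (star a) a′ → a′ ≡ a
    star-centred a A′ with isStar (star a)
    ... | inj₁ A≤1 = A≤1 A′ (star-A a)
    ... | inj₂ B≤1 =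
      ⊥-elim (j₀-missed (star a) (sym (centre-unique _ (InB? (star a)) B≤1 (proj₂ (proj₂ (covers a j₀))))))

    star-injective : Injective _≡_ _≡_ star
    star-injective {a} {a′} e = star-centred a′ (subst (λ f → InA f a) e (star-A a))

    star-surjective : ∀ f → ∃ λ a → star a ≡ f
    star-surjective = injective⇒surjective m≤k star star-injective

    contains : ∀ f j → InB f j
    contains f j with star-surjective f
    ... | a , refl with covers a j
    ...   | g , Aa , Bj with star-surjective g
    ...     | a′ , refl with star-centred a′ Aa
    ...       | refl = Bj

inject₁²≢suc² : ∀ {n} (t : Fin n) → inject₁ (inject₁ t) ≢ suc (suc t)
inject₁²≢suc² zero    ()
inject₁²≢suc² (suc t) = inject₁²≢suc² t ∘ fin-suc-injective

closed-walk-neighbours : ∀ {X : Set} (_~_ : Rel X 0ℓ) → (∀ {x y} → x ~ y → y ~ x) →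
  ∀ {K} → 2 ≤ K → (c : Fin (suc K) → X) →
  (∀ i → c (inject₁ i) ~ c (suc i)) → c (fromℕ K) ~ c zero →
  ∀ i → ∃₂ λ p q → p ≢ q × c i ~ c p × c i ~ c q
closed-walk-neighbours _~_ ~-sym (s≤s (s≤s z≤n)) c step close zero =
  fromℕ _ , suc zero , (λ ()) , ~-sym close , step zero
closed-walk-neighbours _~_ ~-sym (s≤s (s≤s z≤n)) c step close (suc j) with view j
... | ‵fromℕ = inject₁ j , zero , (λ ()) , ~-sym (step j) , close
... | ‵inj₁ {i = t} _ =
  inject₁ j , suc (suc t) , inject₁²≢suc² t , ~-sym (step j) , step (suc t)

module Peeling {X : Set} (_~_ : Rel X 0ℓ) (P : Pred X 0ℓ) where

  -- x is left after m rounds of deleting every vertex of degree at most one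
  -- from the subgraph induced by P.
  Survives : ℕ → Pred X 0ℓ
  Survives zero    x = P x
  Survives (suc m) x = P x × ∃₂ λ y z → y ≢ z × x ~ y × x ~ z × Survives m y × Survives m z

  survives-pred : ∀ m {x} → Survives (suc m) x → Survives m x
  survives-pred zero    (Px , _) = Px
  survives-pred (suc m) (Px , y , z , y≢z , x~y , x~z , Sy , Sz) =
    Px , y , z , y≢z , x~y , x~z , survives-pred m Sy , survives-pred m Sz

  one-neighbour⇒¬survives : ∀ m {x x₀} → (∀ {y} → x ~ y → Survives m y → y ≡ x₀) →
                           ¬ Survives (suc m) x
  one-neighbour⇒¬survives _ only (_ , y , z , y≢z , x~y , x~z , Sy , Sz) =
    y≢z (trans (only x~y Sy) (sym (only x~z Sz)))

survives-map : ∀ {X Y : Set} {_~_ : Rel X 0ℓ} {_≈_ : Rel Y 0ℓ} {P : Pred X 0ℓ} {Q : Pred Y 0ℓ}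
  (h : X → Y) → Injective _≡_ _≡_ h → (∀ {x y} → x ~ y → h x ≈ h y) → (∀ {x} → P x → Q (h x)) →
  ∀ m {x} → Peeling.Survives _~_ P m x → Peeling.Survives _≈_ Q m (h x)
survives-map h h-inj h-hom h-P zero Px = h-P Px
survives-map h h-inj h-hom h-P (suc m) (Px , y , z , y≢z , x~y , x~z , Sy , Sz) =
  h-P Px , h y , h z , y≢z ∘ h-inj , h-hom x~y , h-hom x~z ,
  survives-map h h-inj h-hom h-P m Sy , survives-map h h-inj h-hom h-P m Sz

module _ {G : Graph} where

  Adj-sym : ∀ {u v} → Adj G u v → Adj G v u
  Adj-sym {u} {v} uv = trans (Graph.sym G v u) uv

  Adj⇒≢ : ∀ {u v} → Adj G u v → u ≢ v
  Adj⇒≢ {u} uu refl with trans (sym uu) (irrefl G u)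
  ... | ()

  cycle-survives : ∀ {S} (C : Cycle G) → (∀ i → Cycle.c C i ∈ S) →
                   ∀ m i → Peeling.Survives (Adj G) (_∈ S) m (Cycle.c C i)
  cycle-survives {S} C inS = survives
    where
    open Cycle C
    survives : ∀ m i → Peeling.Survives (Adj G) (_∈ S) m (c i)
    survives zero    i = inS i
    survives (suc m) i with closed-walk-neighbours (Adj G) Adj-sym len≥3 c step close i
    ... | p , q , p≢q , ip , iq = inS i , c p , c q , p≢q ∘ inj , ip , iq , survives m p , survives m q

  ¬survives⇒forest : ∀ {S} m → (∀ x → ¬ Peeling.Survives (Adj G) (_∈ S) m x) → IsInducedForest G S
  ¬survives⇒forest m none (C , inS) = none _ (cycle-survives C inS m zero)

  square⇒¬forest : ∀ {S w x y z} → IsInducedForest G S →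
    Adj G w x → Adj G x y → Adj G y z → Adj G z w → w ≢ y → x ≢ z →
    w ∈ S → x ∈ S → y ∈ S → z ∈ S → ⊥
  square⇒¬forest {S} {w} {x} {y} {z} forest wx xy yz zw w≢y x≢z w∈ x∈ y∈ z∈ =
    forest (square , square-⊆)
    where
    corner : Fin 4 → Fin (n G)
    corner zero                   = w
    corner (suc zero)             = x
    corner (suc (suc zero))       = y
    corner (suc (suc (suc zero))) = z

    corner-injective : Injective _≡_ _≡_ corner
    corner-injective {zero}                   {zero}                   _ = refl
    corner-injective {suc zero}               {suc zero}               _ = refl
    corner-injective {suc (suc zero)}         {suc (suc zero)}         _ = refl
    corner-injective {suc (suc (suc zero))}   {suc (suc (suc zero))}   _ = refl
    corner-injective {zero}                   {suc zero}               e = ⊥-elim (Adj⇒≢ wx e)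
    corner-injective {suc zero}               {zero}                   e = ⊥-elim (Adj⇒≢ wx (sym e))
    corner-injective {suc zero}               {suc (suc zero)}         e = ⊥-elim (Adj⇒≢ xy e)
    corner-injective {suc (suc zero)}         {suc zero}               e = ⊥-elim (Adj⇒≢ xy (sym e))
    corner-injective {suc (suc zero)}         {suc (suc (suc zero))}   e = ⊥-elim (Adj⇒≢ yz e)
    corner-injective {suc (suc (suc zero))}   {suc (suc zero)}         e = ⊥-elim (Adj⇒≢ yz (sym e))
    corner-injective {suc (suc (suc zero))}   {zero}                   e = ⊥-elim (Adj⇒≢ zw e)
    corner-injective {zero}                   {suc (suc (suc zero))}   e = ⊥-elim (Adj⇒≢ zw (sym e))
    corner-injective {zero}                   {suc (suc zero)}         e = ⊥-elim (w≢y e)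
    corner-injective {suc (suc zero)}         {zero}                   e = ⊥-elim (w≢y (sym e))
    corner-injective {suc zero}               {suc (suc (suc zero))}   e = ⊥-elim (x≢z e)
    corner-injective {suc (suc (suc zero))}   {suc zero}               e = ⊥-elim (x≢z (sym e))

    corner-step : ∀ (i : Fin 3) → Adj G (corner (inject₁ i)) (corner (suc i))
    corner-step zero             = wx
    corner-step (suc zero)       = xy
    corner-step (suc (suc zero)) = yz

    square : Cycle G
    square = record { k = 3 ; len≥3 = s≤s (s≤s z≤n) ; c = corner ; inj = corner-injective
                    ; step = corner-step ; close = zw }

    square-⊆ : ∀ i → corner i ∈ S
    square-⊆ zero                   = w∈
    square-⊆ (suc zero)             = x∈
    square-⊆ (suc (suc zero))       = y∈
    square-⊆ (suc (suc (suc zero))) = z∈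

module FromEdges {X : Set} {N : ℕ} (code : X ↔ Fin N)
  {E : Rel X 0ℓ} (E? : Decidable E) (E-irrefl : ∀ {x} → ¬ E x x) where

  open Inverse code public using (to; from)
  open Inverse code using (strictlyInverseˡ; strictlyInverseʳ)

  _~_ : Rel X 0ℓ
  x ~ y = E x y ⊎ E y x

  _~?_ : Decidable _~_
  x ~? y = E? x y ⊎-dec E? y x

  graph : Graph
  graph = record
    { n      = N
    ; adj    = λ p q → does (from p ~? from q)
    ; sym    = λ p q → does-⇔ (mk⇔ swap swap) (from p ~? from q) (from q ~? from p)
    ; irrefl = λ p → dec-false (from p ~? from p) [ E-irrefl , E-irrefl ]
    }

  to-injective : Injective _≡_ _≡_ to
  to-injective {x} {y} e = trans (sym (strictlyInverseʳ x)) (trans (cong from e) (strictlyInverseʳ y))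

  from-injective : Injective _≡_ _≡_ from
  from-injective {p} {q} e = trans (sym (strictlyInverseˡ p)) (trans (cong to e) (strictlyInverseˡ q))

  Adj⇒~ : ∀ {p q} → Adj graph p q → from p ~ from q
  Adj⇒~ {p} {q} = does-true (from p ~? from q)
    where
    does-true : ∀ {A : Set} (A? : Dec A) → does A? ≡ true → A
    does-true (yes a) _ = a

  ~⇒Adj : ∀ {x y} → x ~ y → Adj graph (to x) (to y)
  ~⇒Adj {x} {y} x~y =
    dec-true (_ ~? _) (subst₂ _~_ (sym (strictlyInverseʳ x)) (sym (strictlyInverseʳ y)) x~y)

  module _ {P : Pred X 0ℓ} (P? : Decidable₁ P) where

    codes : Subset N
    codes = tabulate (λ p → does (P? (from p)))

    ∈codes⁺ : ∀ {p} → P (from p) → p ∈ codes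
    ∈codes⁺ {p} Pp = lookup⇒[]= p codes (trans (lookup∘tabulate _ p) (dec-true (P? (from p)) Pp))

    ∈codes⁻ : ∀ {p} → p ∈ codes → P (from p)
    ∈codes⁻ {p} p∈ with P? (from p) | trans (sym (lookup∘tabulate _ p)) ([]=⇒lookup p∈)
    ... | yes Pp | _ = Pp

-- Two copies (indexed by b) of K_{k,k+1}, with parts {left b a} and {right b j}, joined by a
-- bridge between the vertices right false 0 and right true 0.
Vertex : ℕ → Set
Vertex k = Bool × (Fin k ⊎ Fin (suc k))

pattern left  b a = b , inj₁ a
pattern right b j = b , inj₂ j

data Edge {k : ℕ} : Rel (Vertex k) 0ℓ where
  spoke  : ∀ b a j → Edge (left b a) (right b j)
  bridge : Edge (right false zero) (right true zero)

Edge-irrefl : ∀ {k} {x : Vertex k} → ¬ Edge x x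
Edge-irrefl ()

edge? : ∀ {k} → Decidable (Edge {k})
edge? (left b a)         (left c a′)        = no λ ()
edge? (left b a)         (right c j) with b ≟ᵇ c
... | yes refl = yes (spoke b a j)
... | no  b≢c  = no λ { (spoke _ _ _) → b≢c refl }
edge? (right b j)        (left c a)         = no λ ()
edge? (right false zero) (right true zero)  = yes bridge
edge? (right false zero) (right false j)    = no λ ()
edge? (right false zero) (right true (suc j)) = no λ ()
edge? (right true zero)  (right c j)        = no λ ()
edge? (right b (suc i))  (right c j)        = no λ ()

vertexCode : ∀ {k} → Vertex k ↔ Fin (2 * (k + suc k))
vertexCode = ↔-sym (↔-trans *↔× (2↔Bool ×-↔ +↔⊎))

module Construction (k : ℕ) where

  open FromEdges (vertexCode {k}) edge? Edge-irrefl public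

  data InForest (i : Fin k) : Pred (Vertex k) 0ℓ where
    on-left  : ∀ b → InForest i (left b i)
    on-right : ∀ b j → InForest i (right b j)

  inForest? : ∀ i → Decidable₁ (InForest i)
  inForest? i (left b a) with a ≟ i
  ... | yes refl = yes (on-left b)
  ... | no  a≢i  = no λ { (on-left _) → a≢i refl }
  inForest? i (right b j) = yes (on-right b j)

  module _ (i : Fin k) where

    open Peeling _~_ (InForest i)

    leaf-dies : ∀ {b j} → ¬ Survives 1 (right b (suc j))
    leaf-dies {b} = one-neighbour⇒¬survives 0 neighbour
      where
      neighbour : ∀ {j y} → right b (suc j) ~ y → InForest i y → y ≡ left b i
      neighbour (inj₂ (spoke _ _ _)) (on-left _) = refl

    centre-dies : ∀ {b a} → ¬ Survives 2 (left b a)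
    centre-dies {b} = one-neighbour⇒¬survives 1 neighbour
      where
      neighbour : ∀ {a y} → left b a ~ y → Survives 1 y → y ≡ right b zero
      neighbour (inj₁ (spoke _ _ zero))    _  = refl
      neighbour (inj₁ (spoke _ _ (suc j))) Sy = ⊥-elim (leaf-dies Sy)

    root-dies : ∀ {b} → ¬ Survives 3 (right b zero)
    root-dies {b} = one-neighbour⇒¬survives 2 neighbour
      where
      neighbour : ∀ {y} → right b zero ~ y → Survives 2 y → y ≡ right (not b) zero
      neighbour (inj₁ bridge)              _  = refl
      neighbour (inj₂ bridge)              _  = refl
      neighbour (inj₂ (spoke _ _ _)) Sy = ⊥-elim (centre-dies Sy)

    nothing-survives : ∀ x → ¬ Survives 3 x
    nothing-survives (left b a)        = centre-dies ∘ survives-pred 2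
    nothing-survives (right b zero)    = root-dies
    nothing-survives (right b (suc j)) = leaf-dies ∘ survives-pred 1 ∘ survives-pred 2

    isInducedForest : IsInducedForest graph (codes (inForest? i))
    isInducedForest = ¬survives⇒forest 3 λ p →
      nothing-survives (from p) ∘ survives-map from from-injective Adj⇒~ (∈codes⁻ (inForest? i)) 3

  forestCover : Fin k → ForestCover graph k
  forestCover i₀ = record
    { F      = λ i → codes (inForest? i)
    ; forest = isInducedForest
    ; covers = λ p q → map₂ (map (∈codes⁺ (inForest? _)) (∈codes⁺ (inForest? _))) ∘ common ∘ Adj⇒~
    }
    where
    common : ∀ {x y} → x ~ y → ∃ λ i → InForest i x × InForest i y
    common (inj₁ (spoke b a j)) = a  , on-left b , on-right b j
    common (inj₂ (spoke b a j)) = a  , on-right b j , on-left b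
    common (inj₁ bridge)        = i₀ , on-right _ _ , on-right _ _
    common (inj₂ bridge)        = i₀ , on-right _ _ , on-right _ _

  module Copy {m : ℕ} (C : ForestCover graph m) (b : Bool) where
    open ForestCover C

    InA : Fin m → Pred (Fin k) 0ℓ
    InA f a = to (left b a) ∈ F f

    InB : Fin m → Pred (Fin (suc k)) 0ℓ
    InB f j = to (right b j) ∈ F f

    spoke-adj : ∀ a j → Adj graph (to (left b a)) (to (right b j))
    spoke-adj a j = ~⇒Adj (inj₁ (spoke b a j))

    spoke-adj′ : ∀ a j → Adj graph (to (right b j)) (to (left b a))
    spoke-adj′ a j = ~⇒Adj (inj₂ (spoke b a j))

    no-square : ∀ f → DistinctPair (InA f) → DistinctPair (InB f) → ⊥
    no-square f (a , a′ , a≢a′ , Aa , Aa′) (j , j′ , j≢j′ , Bj , Bj′) =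
      square⇒¬forest (forest f)
        (spoke-adj a j) (spoke-adj′ a′ j) (spoke-adj a′ j′) (spoke-adj′ a j′)
        (a≢a′ ∘ inj₁-injective ∘ ,-injectiveʳ ∘ to-injective {left b a} {left b a′})
        (j≢j′ ∘ inj₂-injective ∘ ,-injectiveʳ ∘ to-injective {right b j} {right b j′})
        Aa Bj Aa′ Bj′

    open StarCover InA InB (λ f a → _ ∈? F f) (λ f j → _ ∈? F f)
      (λ a j → covers _ _ (spoke-adj a j)) no-square public

  no-smaller-cover : ∀ m → m < k → ¬ ForestCover graph m
  no-smaller-cover m m<k C = Copy.too-few-stars C false m<k (m<n⇒m<1+n m<k)

  bridge-in-every-forest : (C : ForestCover graph k) → ∀ b f → to (right b zero) ∈ ForestCover.F C f
  bridge-in-every-forest C b f = Copy.stars-contain-B C b ≤-refl (n<1+n k) f zero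

proposition1 : ∀ (k : ℕ) → k ≥ 2 →
    Σ Graph λ G → InducedArboricity G k ×
      Σ (Fin (n G)) λ u → Σ (Fin (n G)) λ v → Adj G u v ×
        (∀ (C : ForestCover G k) → ∀ i → EdgeIn G u v (ForestCover.F C i))
proposition1 zero ()
proposition1 k@(suc _) _ =
  graph , (forestCover zero , no-smaller-cover) ,
  to (right false zero) , to (right true zero) , ~⇒Adj (inj₁ bridge) ,
  λ C i → bridge-in-every-forest C false i , bridge-in-every-forest C true i
  where open Construction k
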